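{- Let $A$ be a unital associative $K$-algebra. If two NCS systems over $A$ have the same $j$-th component for some $1\le j\le 5$, then they are equal; i.e., any single component of an NCS system over $A$ determines all the others.
   Context: $K$ is a unital commutative $\mathbb{Q}$-algebra; $t$ is a formal central parameter. An NCS system over $A$ is a $5$-tuple $(f(t),g(t),d(t),h(t),m(t))\in A[[t]]^{\times5}$ with $d(0)=0$ satisfying $f(0)=1$; $f(-t)g(t)=g(t)f(-t)=1$; $e^{d(t)}=g(t)$ (with $e^{d(t)}=\sum_{k\ge0}d(t)^k/k!$); $g'(t)=g(t)h(t)$; $g'(t)=m(t)g(t)$, where $'$ denotes $d/dt$. -}

module Defs where

open import Level using (Level; _⊔_) renaming (suc to lsuc)
open import Data.Nat using (ℕ; zero; suc; _∸_; _!)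
open import Data.Nat.Properties using (_!≢0)
open import Data.Integer using (+_)
open import Data.Rational using (ℚ; _/_)
import Data.Rational.Properties as ℚP
open import Data.Fin using (Fin; zero; suc)
open import Algebra.Bundles using (CommutativeRing; Ring)
open import Algebra.Morphism.Structures using (module RingMorphisms)

record ℚAlgebra (c ℓ : Level) : Set (lsuc (c ⊔ ℓ)) where
  field
    baseRing : CommutativeRing c ℓ
  open CommutativeRing baseRing public hiding (ring)
  field
    ι     : ℚ → Carrier
    ι-hom : RingMorphisms.IsRingHomomorphism
              (CommutativeRing.rawRing ℚP.+-*-commutativeRing) rawRing ι

record Algebra {c ℓ : Level} (K : ℚAlgebra c ℓ) (a ℓa : Level)
       : Set (c ⊔ ℓ ⊔ lsuc (a ⊔ ℓa)) where
  field
    algRing : Ring a ℓa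
  open Ring algRing public
  field
    η       : ℚAlgebra.Carrier K → Carrier
    η-hom   : RingMorphisms.IsRingHomomorphism (ℚAlgebra.rawRing K) rawRing η
    central : ∀ k x → η k * x ≈ x * η k

-- Formal power series A[[t]] in a central variable t, as coefficient sequences.
module PowerSeries {c ℓ a ℓa : Level} {K : ℚAlgebra c ℓ} (A : Algebra K a ℓa) where
  open Algebra A

  PS : Set a
  PS = ℕ → Carrier

  _≋_ : PS → PS → Set ℓa
  f ≋ g = ∀ n → f n ≈ g n

  sumTo : (ℕ → Carrier) → ℕ → Carrier
  sumTo u zero    = u 0
  sumTo u (suc n) = sumTo u n + u (suc n)

  onePS : PS
  onePS zero    = 1#
  onePS (suc _) = 0#

  _⊛_ : PS → PS → PS
  (f ⊛ g) n = sumTo (λ i → f i * g (n ∸ i)) n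

  powPS : PS → ℕ → PS
  powPS d zero    = onePS
  powPS d (suc k) = d ⊛ powPS d k

  _•_ : ℕ → Carrier → Carrier
  zero  • x = 0#
  suc n • x = x + (n • x)

  deriv : PS → PS
  deriv f n = suc n • f (suc n)

  -- f(-t): coefficient n multiplied by (-1)^n
  alt : ℕ → Carrier → Carrier
  alt zero    x = x
  alt (suc n) x = - alt n x

  negT : PS → PS
  negT f n = alt n (f n)

  invFact : ℕ → Carrier
  invFact k = η (ℚAlgebra.ι K (_/_ (+ 1) (k !) {{k !≢0}}))

  -- e^{d(t)} = Σ_{k≥0} d(t)^k / k!  (for d(0) = 0; the k-th term has
  -- no coefficients below t^k, so coefficient n only involves k ≤ n)
  expPS : PS → PS
  expPS d n = sumTo (λ k → invFact k * powPS d k n) n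

  record NCS : Set (a ⊔ ℓa) where
    field
      f g d h m : PS
      d0   : d 0 ≈ 0#
      f0   : f 0 ≈ 1#
      fg   : (negT f ⊛ g) ≋ onePS
      gf   : (g ⊛ negT f) ≋ onePS
      expd : expPS d ≋ g
      gh   : deriv g ≋ (g ⊛ h)
      mg   : deriv g ≋ (m ⊛ g)

  -- the j-th component (j = 1..5 encoded as Fin 5 = 0..4)
  component : Fin 5 → NCS → PS
  component zero                         S = NCS.f S
  component (suc zero)                   S = NCS.g S
  component (suc (suc zero))             S = NCS.d S
  component (suc (suc (suc zero)))       S = NCS.h S
  component (suc (suc (suc (suc zero)))) S = NCS.m S

  _≈NCS_ : NCS → NCS → Set ℓa
  S ≈NCS T = ∀ j → component j S ≋ component j T

-- Every component is interchangeable with g.  Since f(0) = 1 = g(0), a series with constant term 1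
-- cancels from either side of a Cauchy product, so f(-t) g = 1 makes f and g determine each other,
-- and g' = g h, g' = m g determine h and m.  Conversely these equations recover g coefficient by
-- coefficient from g(0) = 1, since n + 1 is invertible in a ℚ-algebra.  As d(0) = 0, the coefficient
-- of t^(n+1) in e^d is d_(n+1) plus terms built from d_1, …, d_n only, so g = e^d and d determine
-- each other by induction.

module Submission where

open import Defs
open import Level using (Level)
open import Algebra.Bundles using (CommutativeRing; Ring)
open import Algebra.Morphism.Structures using (module RingMorphisms)
open import Algebra.Morphism.Construct.Composition using (isRingHomomorphism)
open import Data.Empty using (⊥-elim)
open import Data.Fin using (Fin; zero; suc)
open import Data.Nat using (ℕ; zero; suc; _∸_; _≤_; _<_; z≤n; s≤s)
open import Data.Nat.Induction using (<-rec)
open import Data.Nat.Properties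
  using (≤-refl; ≤-<-trans; ≤∧≢⇒<; m≤n⇒m<n∨m≡n; m≤n⇒m≤1+n; <⇒≢; m∸n≤m; n∸n≡0; +-∸-assoc; n<1+n)
open import Data.Rational using (ℚ; 1ℚ; 1/_; Positive) renaming (_*_ to _*ℚ_)
import Data.Rational.Properties as ℚP
open import Data.Sum using (inj₁; inj₂)
open import Relation.Binary.PropositionalEquality as ≡ using (_≢_; ≢-sym)

module _ {a ℓ : Level} (R : Ring a ℓ) {φ : ℚ → Ring.Carrier R}
         (φ-hom : RingMorphisms.IsRingHomomorphism
                    (CommutativeRing.rawRing ℚP.+-*-commutativeRing) (Ring.rawRing R) φ)
         where
  open Ring R
  open RingMorphisms.IsRingHomomorphism φ-hom
  open import Algebra.Properties.Semiring.Mult semiring using (_×_; ×-congʳ; ×-assoc-*)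
  open import Algebra.Properties.Monoid.Mult ℚP.+-0-monoid using () renaming (_×_ to _×ℚ_)
  open import Relation.Binary.Reasoning.Setoid setoid

  private
    φ-×ℚ-1ℚ : ∀ n → φ (n ×ℚ 1ℚ) ≈ n × 1#
    φ-×ℚ-1ℚ zero    = 0#-homo
    φ-×ℚ-1ℚ (suc n) = trans (+-homo 1ℚ (n ×ℚ 1ℚ)) (+-cong 1#-homo (φ-×ℚ-1ℚ n))

    suc-×ℚ-1ℚ-positive : ∀ n → Positive (suc n ×ℚ 1ℚ)
    suc-×ℚ-1ℚ-positive zero    = _
    suc-×ℚ-1ℚ-positive (suc n) = ℚP.pos+pos⇒pos 1ℚ (suc n ×ℚ 1ℚ) {{suc-×ℚ-1ℚ-positive n}}

  ×-cancel-suc : ∀ n {x y} → suc n × x ≈ suc n × y → x ≈ y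
  ×-cancel-suc n {x} {y} e = trans (sym (inverse-scales x)) (trans (*-congˡ e) (inverse-scales y))
    where
    m : ℚ
    m = suc n ×ℚ 1ℚ
    instance
      _ = ℚP.pos⇒nonZero m {{suc-×ℚ-1ℚ-positive n}}

    inverse-scales : ∀ z → φ (1/ m) * (suc n × z) ≈ z
    inverse-scales z = begin
      φ (1/ m) * (suc n × z)        ≈⟨ *-congˡ (×-congʳ (suc n) (*-identityˡ z)) ⟨
      φ (1/ m) * (suc n × (1# * z)) ≈⟨ *-congˡ (×-assoc-* (suc n) 1# z) ⟨
      φ (1/ m) * (suc n × 1# * z)   ≈⟨ *-congˡ (*-congʳ (φ-×ℚ-1ℚ (suc n))) ⟨
      φ (1/ m) * (φ m * z)          ≈⟨ *-assoc _ _ _ ⟨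
      φ (1/ m) * φ m * z            ≈⟨ *-congʳ (*-homo (1/ m) m) ⟨
      φ (1/ m *ℚ m) * z             ≈⟨ *-congʳ (⟦⟧-cong (ℚP.*-inverseˡ m)) ⟩
      φ 1ℚ * z                      ≈⟨ *-congʳ 1#-homo ⟩
      1# * z                        ≈⟨ *-identityˡ z ⟩
      z                             ∎

module _ {c ℓ a ℓa : Level} {K : ℚAlgebra c ℓ} (A : Algebra K a ℓa) where
  open Algebra A hiding (zero)
  open PowerSeries A
  open import Algebra.Properties.Ring algRing using (-‿injective)
  open import Algebra.Properties.AbelianGroup +-abelianGroup using (∙-cancelˡ)
  open import Algebra.Properties.CommutativeSemigroup +-commutativeSemigroup using (xy∙z≈xz∙y)
  open import Relation.Binary.Reasoning.Setoid setoid

  φ-hom : RingMorphisms.IsRingHomomorphism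
            (CommutativeRing.rawRing ℚP.+-*-commutativeRing) rawRing (λ q → η (ℚAlgebra.ι K q))
  φ-hom = isRingHomomorphism trans (ℚAlgebra.ι-hom K) η-hom

  •-cancel-suc : ∀ n {x y} → suc n • x ≈ suc n • y → x ≈ y
  •-cancel-suc n {x} {y} e =
    ×-cancel-suc algRing φ-hom n (trans (sym (•≈× (suc n) x)) (trans e (•≈× (suc n) y)))
    where
    open import Algebra.Properties.Monoid.Mult +-monoid using (_×_)

    •≈× : ∀ n z → n • z ≈ n × z
    •≈× zero    z = refl
    •≈× (suc n) z = +-congˡ (•≈× n z)

  invFact-1 : invFact 1 ≈ 1#
  invFact-1 = RingMorphisms.IsRingHomomorphism.1#-homo φ-hom

  sumTo-cong : ∀ {u v} n → (∀ i → i ≤ n → u i ≈ v i) → sumTo u n ≈ sumTo v n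
  sumTo-cong zero    e = e 0 z≤n
  sumTo-cong (suc n) e = +-cong (sumTo-cong n (λ i i≤n → e i (m≤n⇒m≤1+n i≤n))) (e (suc n) ≤-refl)

  sumTo-zero : ∀ {u} n → (∀ i → i ≤ n → u i ≈ 0#) → sumTo u n ≈ 0#
  sumTo-zero zero    e = e 0 z≤n
  sumTo-zero (suc n) e =
    trans (+-cong (sumTo-zero n (λ i i≤n → e i (m≤n⇒m≤1+n i≤n))) (e (suc n) ≤-refl)) (+-identityˡ 0#)

  sumTo-+-swap : ∀ {u v} n j → j ≤ n → (∀ i → i ≤ n → i ≢ j → u i ≈ v i)
               → sumTo u n + v j ≈ sumTo v n + u j
  sumTo-+-swap zero .zero z≤n e = +-comm _ _
  sumTo-+-swap {u} {v} (suc n) j j≤1+n e with m≤n⇒m<n∨m≡n j≤1+n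
  ... | inj₂ ≡.refl = begin
    sumTo u n + u (suc n) + v (suc n) ≈⟨ xy∙z≈xz∙y _ _ _ ⟩
    sumTo u n + v (suc n) + u (suc n)
      ≈⟨ +-congʳ (+-congʳ (sumTo-cong n (λ i i≤n → e i (m≤n⇒m≤1+n i≤n) (<⇒≢ (s≤s i≤n))))) ⟩
    sumTo v n + v (suc n) + u (suc n) ∎
  ... | inj₁ (s≤s j≤n) = begin
    sumTo u n + u (suc n) + v j ≈⟨ xy∙z≈xz∙y _ _ _ ⟩
    sumTo u n + v j + u (suc n) ≈⟨ +-cong (sumTo-+-swap n j j≤n (λ i i≤n → e i (m≤n⇒m≤1+n i≤n)))
                                          (e (suc n) ≤-refl (≢-sym (<⇒≢ (s≤s j≤n)))) ⟩
    sumTo v n + u j + v (suc n) ≈⟨ xy∙z≈xz∙y _ _ _ ⟩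
    sumTo v n + v (suc n) + u j ∎

  sumTo-cancel : ∀ {u v} n j → j ≤ n → (∀ i → i ≤ n → i ≢ j → u i ≈ v i)
               → sumTo u n ≈ sumTo v n → u j ≈ v j
  sumTo-cancel {u} {v} n j j≤n e sums = sym (∙-cancelˡ (sumTo v n) (v j) (u j) (begin
    sumTo v n + v j ≈⟨ +-congʳ sums ⟨
    sumTo u n + v j ≈⟨ sumTo-+-swap n j j≤n e ⟩
    sumTo v n + u j ∎))

  ≋-sym : ∀ {f g} → f ≋ g → g ≋ f
  ≋-sym e n = sym (e n)

  EqualBelow : ℕ → PS → PS → Set ℓa
  EqualBelow n f g = ∀ {i} → i < n → f i ≈ g i

  ≋-by-<-induction : ∀ {f g} → (∀ n → EqualBelow n f g → f n ≈ g n) → f ≋ g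
  ≋-by-<-induction {f} {g} = <-rec (λ n → f n ≈ g n)

  ⊛-cong : ∀ {f f' g g'} → f ≋ f' → g ≋ g' → (f ⊛ g) ≋ (f' ⊛ g')
  ⊛-cong ef eg n = sumTo-cong n (λ i _ → *-cong (ef i) (eg (n ∸ i)))

  ⊛-congˡ : ∀ f {g g'} → g ≋ g' → (f ⊛ g) ≋ (f ⊛ g')
  ⊛-congˡ f e = ⊛-cong {f = f} (λ _ → refl) e

  ⊛-congʳ : ∀ {f f'} g → f ≋ f' → (f ⊛ g) ≋ (f' ⊛ g)
  ⊛-congʳ g e = ⊛-cong {g = g} e (λ _ → refl)

  ⊛-congBelow : ∀ {f f' g g'} n → EqualBelow n f f' → EqualBelow n g g'
              → EqualBelow n (f ⊛ g) (f' ⊛ g')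
  ⊛-congBelow n ef eg {i} i<n =
    sumTo-cong i (λ l l≤i → *-cong (ef (≤-<-trans l≤i i<n)) (eg (≤-<-trans (m∸n≤m i l) i<n)))

  ⊛-identityʳ : ∀ f → (f ⊛ onePS) ≋ f
  ⊛-identityʳ f zero    = *-identityʳ (f 0)
  ⊛-identityʳ f (suc n) = begin
    sumTo (λ i → f i * onePS (suc n ∸ i)) n + f (suc n) * onePS (n ∸ n)
      ≈⟨ +-cong (sumTo-zero n (λ i i≤n → trans (*-congˡ (reflexive (≡.cong onePS (+-∸-assoc 1 i≤n)))) (zeroʳ _)))
                (*-congˡ (reflexive (≡.cong onePS (n∸n≡0 n)))) ⟩
    0# + f (suc n) * 1# ≈⟨ +-identityˡ _ ⟩
    f (suc n) * 1#      ≈⟨ *-identityʳ _ ⟩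
    f (suc n)           ∎

  1-cancelˡ : ∀ {u x y} → u ≈ 1# → u * x ≈ u * y → x ≈ y
  1-cancelˡ {u} {x} {y} u≈1 e = begin
    x      ≈⟨ *-identityˡ x ⟨
    1# * x ≈⟨ *-congʳ u≈1 ⟨
    u * x  ≈⟨ e ⟩
    u * y  ≈⟨ *-congʳ u≈1 ⟩
    1# * y ≈⟨ *-identityˡ y ⟩
    y      ∎

  1-cancelʳ : ∀ {u x y} → u ≈ 1# → x * u ≈ y * u → x ≈ y
  1-cancelʳ {u} {x} {y} u≈1 e = begin
    x      ≈⟨ *-identityʳ x ⟨
    x * 1# ≈⟨ *-congˡ u≈1 ⟨
    x * u  ≈⟨ e ⟩
    y * u  ≈⟨ *-congˡ u≈1 ⟩
    y * 1# ≈⟨ *-identityʳ y ⟩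
    y      ∎

  ⊛-cancelˡ : ∀ p {x y} → p 0 ≈ 1# → (p ⊛ x) ≋ (p ⊛ y) → x ≋ y
  ⊛-cancelˡ p {x} {y} p₀≈1 e = ≋-by-<-induction λ n below →
    let other : ∀ i → i ≤ n → i ≢ 0 → p i * x (n ∸ i) ≈ p i * y (n ∸ i)
        other = λ where
          zero    _       i≢0 → ⊥-elim (i≢0 ≡.refl)
          (suc i) (s≤s _) _ → *-congˡ (below (s≤s (m∸n≤m _ i)))
    in 1-cancelˡ p₀≈1 (sumTo-cancel n 0 z≤n other (e n))

  ⊛-cancelʳ : ∀ p {x y} → p 0 ≈ 1# → (x ⊛ p) ≋ (y ⊛ p) → x ≋ y
  ⊛-cancelʳ p {x} {y} p₀≈1 e = ≋-by-<-induction λ n below →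
    let other : ∀ i → i ≤ n → i ≢ n → x i * p (n ∸ i) ≈ y i * p (n ∸ i)
        other i i≤n i≢n = *-congʳ (below (≤∧≢⇒< i≤n i≢n))
    in 1-cancelʳ (trans (reflexive (≡.cong p (n∸n≡0 n))) p₀≈1) (sumTo-cancel n n ≤-refl other (e n))

  •-congʳ : ∀ n {x y} → x ≈ y → n • x ≈ n • y
  •-congʳ zero    e = refl
  •-congʳ (suc n) e = +-cong e (•-congʳ n e)

  deriv-cong : ∀ {f f'} → f ≋ f' → deriv f ≋ deriv f'
  deriv-cong e n = •-congʳ (suc n) (e (suc n))

  deriv≋⊛ʳ-unique : ∀ {g g' h} → g 0 ≈ g' 0 → deriv g ≋ (g ⊛ h) → deriv g' ≋ (g' ⊛ h) → g ≋ g'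
  deriv≋⊛ʳ-unique {g} {g'} {h} g₀≈g'₀ eg eg' = ≋-by-<-induction λ where
    zero    _     → g₀≈g'₀
    (suc n) below → •-cancel-suc n (begin
      suc n • g (suc n)  ≈⟨ eg n ⟩
      (g ⊛ h) n          ≈⟨ ⊛-congBelow {g = h} {g' = h} (suc n) below (λ _ → refl) (n<1+n n) ⟩
      (g' ⊛ h) n         ≈⟨ eg' n ⟨
      suc n • g' (suc n) ∎)

  deriv≋⊛ˡ-unique : ∀ {g g' m} → g 0 ≈ g' 0 → deriv g ≋ (m ⊛ g) → deriv g' ≋ (m ⊛ g') → g ≋ g'
  deriv≋⊛ˡ-unique {g} {g'} {m} g₀≈g'₀ eg eg' = ≋-by-<-induction λ where
    zero    _     → g₀≈g'₀
    (suc n) below → •-cancel-suc n (begin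
      suc n • g (suc n)  ≈⟨ eg n ⟩
      (m ⊛ g) n          ≈⟨ ⊛-congBelow {f = m} {f' = m} (suc n) (λ _ → refl) below (n<1+n n) ⟩
      (m ⊛ g') n         ≈⟨ eg' n ⟨
      suc n • g' (suc n) ∎)

  negT-cong : ∀ {f f'} → f ≋ f' → negT f ≋ negT f'
  negT-cong e n = alt-cong n (e n)
    where
    alt-cong : ∀ n {x y} → x ≈ y → alt n x ≈ alt n y
    alt-cong zero    e = e
    alt-cong (suc n) e = -‿cong (alt-cong n e)

  negT-injective : ∀ {f f'} → negT f ≋ negT f' → f ≋ f'
  negT-injective e n = alt-injective n (e n)
    where
    alt-injective : ∀ n {x y} → alt n x ≈ alt n y → x ≈ y
    alt-injective zero    e = e
    alt-injective (suc n) e = alt-injective n (-‿injective e)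

  NoConstantTerm : PS → Set ℓa
  NoConstantTerm f = f 0 ≈ 0#

  ⊛-congAt : ∀ {f f' g g'} n → NoConstantTerm f → NoConstantTerm f' → NoConstantTerm g → NoConstantTerm g'
           → EqualBelow n f f' → EqualBelow n g g' → (f ⊛ g) n ≈ (f' ⊛ g') n
  ⊛-congAt {f} {f'} {g} {g'} n f₀ f'₀ g₀ g'₀ ef eg = sumTo-cong n term
    where
    annihilateˡ : ∀ {u} x → u ≈ 0# → u * x ≈ 0#
    annihilateˡ x u≈0 = trans (*-congʳ u≈0) (zeroˡ x)

    annihilateʳ : ∀ {u} x → u ≈ 0# → x * u ≈ 0#
    annihilateʳ x u≈0 = trans (*-congˡ u≈0) (zeroʳ x)

    -- The end terms vanish because f 0 ≈ 0# and g 0 ≈ 0#; the others only involve coefficients below n.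
    term : ∀ l → l ≤ n → f l * g (n ∸ l) ≈ f' l * g' (n ∸ l)
    term zero    _ = trans (annihilateˡ _ f₀) (sym (annihilateˡ _ f'₀))
    term (suc l) (s≤s {n = m} l≤m) with m≤n⇒m<n∨m≡n l≤m
    ... | inj₁ l<m    = *-cong (ef (s≤s l<m)) (eg (s≤s (m∸n≤m m l)))
    ... | inj₂ ≡.refl = trans (annihilateʳ _ (trans (reflexive (≡.cong g (n∸n≡0 l))) g₀))
                              (sym (annihilateʳ _ (trans (reflexive (≡.cong g' (n∸n≡0 l))) g'₀)))

  powPS-cong : ∀ {d d'} → d ≋ d' → ∀ k → powPS d k ≋ powPS d' k
  powPS-cong e zero    n = refl
  powPS-cong e (suc k)   = ⊛-cong e (powPS-cong e k)

  powPS-congBelow : ∀ {d d'} n → EqualBelow n d d' → ∀ k → EqualBelow n (powPS d k) (powPS d' k)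
  powPS-congBelow n e zero    _ = refl
  powPS-congBelow n e (suc k)   = ⊛-congBelow n e (powPS-congBelow n e k)

  powPS-suc-noConstantTerm : ∀ {d} → NoConstantTerm d → ∀ k → NoConstantTerm (powPS d (suc k))
  powPS-suc-noConstantTerm d₀ k = trans (*-congʳ d₀) (zeroˡ _)

  expPS-cong : ∀ {d d'} → d ≋ d' → expPS d ≋ expPS d'
  expPS-cong e n = sumTo-cong n (λ k _ → *-congˡ (powPS-cong e k n))

  expPS-injective : ∀ {d d'} → NoConstantTerm d → NoConstantTerm d' → expPS d ≋ expPS d' → d ≋ d'
  expPS-injective {d} {d'} d₀ d'₀ e = ≋-by-<-induction step
    where
    linear-term : ∀ f n → invFact 1 * powPS f 1 n ≈ f n
    linear-term f n = trans (*-congʳ invFact-1) (trans (*-identityˡ _) (⊛-identityʳ f n))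

    other-terms : ∀ n → EqualBelow (suc n) d d' → ∀ k → k ≤ suc n → k ≢ 1
                → invFact k * powPS d k (suc n) ≈ invFact k * powPS d' k (suc n)
    other-terms n below zero          _ _   = refl
    other-terms n below (suc zero)    _ k≢1 = ⊥-elim (k≢1 ≡.refl)
    other-terms n below (suc (suc k)) _ _   = *-congˡ
      (⊛-congAt (suc n) d₀ d'₀ (powPS-suc-noConstantTerm d₀ k) (powPS-suc-noConstantTerm d'₀ k)
                below (powPS-congBelow (suc n) below (suc k)))

    step : ∀ n → EqualBelow n d d' → d n ≈ d' n
    step zero    _     = trans d₀ (sym d'₀)
    step (suc n) below = begin
      d (suc n)                      ≈⟨ linear-term d (suc n) ⟨
      invFact 1 * powPS d 1 (suc n)  ≈⟨ sumTo-cancel (suc n) 1 (s≤s z≤n) (other-terms n below) (e (suc n)) ⟩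
      invFact 1 * powPS d' 1 (suc n) ≈⟨ linear-term d' (suc n) ⟩
      d' (suc n)                     ∎

  g-constant : (S : NCS) → NCS.g S 0 ≈ 1#
  g-constant S = 1-cancelˡ f0 (trans (fg 0) (sym (trans (*-identityʳ (f 0)) f0)))
    where open NCS S

  module _ (S T : NCS) where
    private
      module S = NCS S
      module T = NCS T

      g-constants-agree : S.g 0 ≈ T.g 0
      g-constants-agree = trans (g-constant S) (sym (g-constant T))

    g-determines-NCS : S.g ≋ T.g → S ≈NCS T
    g-determines-NCS e zero = negT-injective (⊛-cancelʳ S.g (g-constant S) λ n → begin
      (negT S.f ⊛ S.g) n ≈⟨ S.fg n ⟩
      onePS n            ≈⟨ T.fg n ⟨
      (negT T.f ⊛ T.g) n ≈⟨ ⊛-congˡ (negT T.f) (≋-sym e) n ⟩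
      (negT T.f ⊛ S.g) n ∎)
    g-determines-NCS e (suc zero) = e
    g-determines-NCS e (suc (suc zero)) = expPS-injective S.d0 T.d0 λ n → begin
      expPS S.d n ≈⟨ S.expd n ⟩
      S.g n       ≈⟨ e n ⟩
      T.g n       ≈⟨ T.expd n ⟨
      expPS T.d n ∎
    g-determines-NCS e (suc (suc (suc zero))) = ⊛-cancelˡ S.g (g-constant S) λ n → begin
      (S.g ⊛ S.h) n ≈⟨ S.gh n ⟨
      deriv S.g n   ≈⟨ deriv-cong e n ⟩
      deriv T.g n   ≈⟨ T.gh n ⟩
      (T.g ⊛ T.h) n ≈⟨ ⊛-congʳ T.h (≋-sym e) n ⟩
      (S.g ⊛ T.h) n ∎
    g-determines-NCS e (suc (suc (suc (suc zero)))) = ⊛-cancelʳ S.g (g-constant S) λ n → begin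
      (S.m ⊛ S.g) n ≈⟨ S.mg n ⟨
      deriv S.g n   ≈⟨ deriv-cong e n ⟩
      deriv T.g n   ≈⟨ T.mg n ⟩
      (T.m ⊛ T.g) n ≈⟨ ⊛-congˡ T.m (≋-sym e) n ⟩
      (T.m ⊛ S.g) n ∎

    component-determines-g : ∀ j → component j S ≋ component j T → S.g ≋ T.g
    component-determines-g zero e = ⊛-cancelˡ (negT S.f) S.f0 λ n → begin
      (negT S.f ⊛ S.g) n ≈⟨ S.fg n ⟩
      onePS n            ≈⟨ T.fg n ⟨
      (negT T.f ⊛ T.g) n ≈⟨ ⊛-congʳ T.g (negT-cong (≋-sym e)) n ⟩
      (negT S.f ⊛ T.g) n ∎
    component-determines-g (suc zero) e = e
    component-determines-g (suc (suc zero)) e n = begin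
      S.g n       ≈⟨ S.expd n ⟨
      expPS S.d n ≈⟨ expPS-cong e n ⟩
      expPS T.d n ≈⟨ T.expd n ⟩
      T.g n       ∎
    component-determines-g (suc (suc (suc zero))) e =
      deriv≋⊛ʳ-unique {h = S.h} g-constants-agree S.gh λ n → trans (T.gh n) (⊛-congˡ T.g (≋-sym e) n)
    component-determines-g (suc (suc (suc (suc zero)))) e =
      deriv≋⊛ˡ-unique {m = S.m} g-constants-agree S.mg λ n → trans (T.mg n) (⊛-congʳ T.g (≋-sym e) n)

corollary2p7 : {c ℓ a ℓa : Level} (K : ℚAlgebra c ℓ) (A : Algebra K a ℓa)
    → let open PowerSeries A in
    (S T : NCS) (j : Fin 5) → component j S ≋ component j T → S ≈NCS T
corollary2p7 K A S T j e = g-determines-NCS A S T (component-determines-g A S T j e)
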